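{- Let $q\ge 14$ be an integer and $n=q^2+q+1$. For every simple $C_4$-free graph $G$ on $n$ vertices, \[ \tau(G)\le \frac{1}{n^2}\,(q+1)^{q+1}\,(q+2)^{\,n-(q+1)}. \] Consequently, \[ \mathrm{st}(n,C_4)\le \frac{1}{n^2}\,(q+1)^{q+1}\,(q+2)^{\,n-(q+1)}. \]
   Context: For a graph $G$, $\tau(G)$ denotes its number of spanning trees (which is $0$ if $G$ is disconnected). A graph is $C_4$-free if it contains no cycle of length $4$ as a subgraph. For $n\in\mathbb N$, $\mathrm{st}(n,C_4)$ is defined as the maximum of $\tau(G)$ over all simple, connected, $C_4$-free graphs $G$ on $n$ vertices. -}

module Defs where

open import Data.Nat using (ℕ; zero; suc; _+_; _*_; _∸_; _^_; _≤_)
open import Data.Bool using (Bool; true; false)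
open import Data.Fin using (Fin; zero; suc; inject₁; fromℕ)
open import Data.Vec using (Vec; lookup)
open import Data.List using (List; length)
open import Data.List.Relation.Unary.All using (All)
open import Data.List.Relation.Unary.Unique.Propositional using (Unique)
open import Data.Product using (_×_; Σ)
open import Relation.Nullary using (¬_)
open import Relation.Binary.PropositionalEquality using (_≡_)
open import Relation.Binary.Construct.Closure.ReflexiveTransitive using (Star)
open import Function.Definitions using (Injective)

Graph : ℕ → Set
Graph n = Vec (Vec Bool n) n

Adj : ∀ {n} → Graph n → Fin n → Fin n → Set
Adj G i j = lookup (lookup G i) j ≡ true

Simple : ∀ {n} → Graph n → Set
Simple G = (∀ i j → Adj G i j → Adj G j i) × (∀ i → ¬ Adj G i i)

_⊆G_ : ∀ {n} → Graph n → Graph n → Set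
H ⊆G G = ∀ i j → Adj H i j → Adj G i j

Connected : ∀ {n} → Graph n → Set
Connected G = ∀ i j → Star (Adj G) i j

-- A cycle of length (m+3) in G: an injective cyclic sequence of vertices
-- with consecutive vertices adjacent (including last-to-first).
Cycle : ∀ {n} → Graph n → ℕ → Set
Cycle {n} G m =
  Σ (Fin (suc (suc (suc m))) → Fin n) λ f →
    Injective _≡_ _≡_ f ×
    (∀ (i : Fin (suc (suc m))) → Adj G (f (inject₁ i)) (f (suc i))) ×
    Adj G (f (fromℕ (suc (suc m)))) (f zero)

Acyclic : ∀ {n} → Graph n → Set
Acyclic G = ∀ m → ¬ Cycle G m

C4Free : ∀ {n} → Graph n → Set
C4Free G = ¬ Cycle G 1

IsSpanningTree : ∀ {n} → Graph n → Graph n → Set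
IsSpanningTree G T = Simple T × T ⊆G G × Connected T × Acyclic T

-- "τ(G) ≤ b": every duplicate-free list of spanning trees of G has length ≤ b.
-- (Spanning trees are identified with their adjacency matrices, i.e. edge sets.)
-- We use the scaled form  c * τ(G) ≤ b.
ScaledτBound : ∀ {n} → Graph n → ℕ → ℕ → Set
ScaledτBound {n} G c b =
  (ts : List (Graph n)) → Unique ts → All (IsSpanningTree G) ts → c * length ts ≤ b

{-# OPTIONS --safe #-}
-- Root every spanning tree T of G at a fixed vertex r and record, for each vertex, its parent on
-- a shortest path to r in T (r records itself).  As T is acyclic, each of its edges joins a vertex
-- to its parent, so T is determined by this vector, whose entry at v ≠ r is a neighbour of v in G;
-- hence τ(G) ≤ ∏ max(d(v), 1).  Without C₄ two distinct vertices have at most one common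
-- neighbour, so ∑ d(v)² ≤ ∑ d(v) + n(n − 1), and summing the tangent-line bound
-- (2q + 1)x ≤ x² + q² + q gives ∑ max(d(v), 1) ≤ (q + 1)n.  AM–GM turns this into
-- τ(G) ≤ (q + 1)ⁿ.  Finally n² (q + 1)^(q²) ≤ (q + 2)^(q²) for q ≥ 14, because
-- (1 + 1/(q + 1))^(q + 1) ≥ 12/5 and (12/5)^(q − 1) ≥ n².
module Submission where

open import Defs
open import Data.Nat using (ℕ; zero; suc; _+_; _*_; _∸_; _^_; _≤_; _<_; z≤n; s≤s; _⊔_; NonZero; >-nonZero)

open import Data.Bool using (Bool; true; false; _∧_) renaming (_≟_ to _≟ᵇ_)
open import Data.Bool.Properties using (⇔→≡; ∧-idem; ∧-conicalˡ; ∧-conicalʳ)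
open import Data.Empty using (⊥-elim)
open import Data.Fin using (Fin; zero; suc; punchIn; inject₁; fromℕ)
open import Data.Fin.Properties using (punchInᵢ≢i; injective⇒≤; any?)
  renaming (_≟_ to _≟ᶠ_; suc-injective to suc-injectiveᶠ)
open import Data.List as List using (List; []; _∷_; _++_; [_]; length; reverse; cartesianProductWith)
open import Data.List.Properties
  using (length-++; length-map; length-reverse; unfold-reverse; reverse-++; ++-assoc)
open import Data.List.Membership.DecPropositional using (_∈?_)
open import Data.List.Membership.Propositional using (_∈_)
open import Data.List.Membership.Propositional.Properties
  using (∈-lookup; ∈-map⁺; ∈-cartesianProductWith⁺; ∈-∃++; ∈-++⁺ˡ; ∈-++⁺ʳ)
open import Data.List.Membership.Setoid.Properties using (index-injective)
open import Data.List.Relation.Binary.Permutation.Setoid using (↭-sym)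
open import Data.List.Relation.Binary.Permutation.Setoid.Properties using (Unique-resp-↭; ↭-reverse)
open import Data.List.Relation.Unary.All as All using (All; []; _∷_)
open import Data.List.Relation.Unary.All.Properties using (++⁻ˡ)
open import Data.List.Relation.Unary.AllPairs using ([]; _∷_)
open import Data.List.Relation.Unary.Any using (here; there; index)
open import Data.List.Relation.Unary.Any.Properties using (reverse⁻)
import Data.List.Relation.Unary.First as First
open import Data.List.Relation.Unary.First.Properties using (¬All⇒First; toView)
open import Data.List.Relation.Unary.Unique.Propositional using (Unique)
import Data.List.Relation.Unary.Unique.Propositional.Properties as Unique
open import Data.Nat.Properties
open import Data.Nat.Tactic.RingSolver using (solve)
open import Data.Product using (_×_; _,_; proj₁; proj₂; ∃; ∃-syntax)
open import Data.Sum using (_⊎_; inj₁; inj₂)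
open import Data.Vec as Vec using (Vec; lookup; tabulate)
open import Data.Vec.Properties using (lookup∘tabulate)
open import Data.Vec.Relation.Binary.Pointwise.Extensional using (ext; Pointwise-≡⇒≡)
open import Function using (_∘_; _∋_)
open import Function.Bundles using (mk⇔)
open import Function.Definitions using (Injective)
open import Relation.Binary.Construct.Closure.ReflexiveTransitive using (Star; ε; _◅_)
open import Relation.Binary.PropositionalEquality
  using (_≡_; _≢_; ≢-sym; refl; sym; trans; cong; cong₂; subst; subst₂; setoid; module ≡-Reasoning)
open import Relation.Nullary using (¬_; Dec; yes; no)
open import Relation.Nullary.Decidable using (¬?; decidable-stable; _×-dec_; _⊎-dec_; from-yes)

open import Algebra.Properties.CommutativeSemigroup *-commutativeSemigroup
  using () renaming (interchange to *-interchange)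
open import Algebra.Properties.Semiring.Sum +-*-semiring
  using (sum; sum-cong-≗; sum-remove; ∑-distrib-+; ∑-comm; *-distribˡ-sum; *-distribʳ-sum)
open import Algebra.Properties.CommutativeMonoid.Sum *-1-commutativeMonoid
  using () renaming (sum to product; ∑-distrib-+ to product-distrib-*)

sum-const : ∀ n c → sum {n} (λ _ → c) ≡ n * c
sum-const zero    c = refl
sum-const (suc n) c = cong (c +_) (sum-const n c)

sum-mono-≤ : ∀ {n} {f g : Fin n → ℕ} → (∀ i → f i ≤ g i) → sum f ≤ sum g
sum-mono-≤ {zero}  f≤g = z≤n
sum-mono-≤ {suc n} f≤g = +-mono-≤ (f≤g zero) (sum-mono-≤ (f≤g ∘ suc))

sum-≤-diagonal : ∀ {n} (a : Fin n) (f : Fin n → ℕ) → (∀ b → b ≢ a → f b ≤ 1) →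
                 sum f + 1 ≤ f a + n
sum-≤-diagonal {suc n} a f off≤1 = begin
  sum f + 1                        ≡⟨ cong (_+ 1) (sum-remove {i = a} f) ⟩
  f a + sum (f ∘ punchIn a) + 1    ≤⟨ +-monoˡ-≤ 1 (+-monoʳ-≤ (f a) rest≤n) ⟩
  f a + n + 1                      ≡⟨ +-assoc (f a) n 1 ⟩
  f a + (n + 1)                    ≡⟨ cong (f a +_) (+-comm n 1) ⟩
  f a + suc n                      ∎
  where
  open ≤-Reasoning
  rest≤n : sum (f ∘ punchIn a) ≤ n
  rest≤n = begin
    sum (f ∘ punchIn a)  ≤⟨ sum-mono-≤ (λ i → off≤1 (punchIn a i) (punchInᵢ≢i a i)) ⟩
    sum {n} (λ _ → 1)    ≡⟨ sum-const n 1 ⟩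
    n * 1                ≡⟨ *-identityʳ n ⟩
    n                    ∎

product-mono-≤ : ∀ {n} {f g : Fin n → ℕ} → (∀ i → f i ≤ g i) → product f ≤ product g
product-mono-≤ {zero}  f≤g = ≤-refl
product-mono-≤ {suc n} f≤g = *-mono-≤ (f≤g zero) (product-mono-≤ (f≤g ∘ suc))

product-const : ∀ n c → product {n} (λ _ → c) ≡ c ^ n
product-const zero    c = refl
product-const (suc n) c = cong (c *_) (product-const n c)

product-pow : ∀ {n} c (f : Fin n → ℕ) → product (λ i → c ^ f i) ≡ c ^ sum f
product-pow {zero}  c f = refl
product-pow {suc n} c f =
  trans (cong (c ^ f zero *_) (product-pow c (f ∘ suc))) (sym (^-distribˡ-+-* c (f zero) _))

module _ {a} {A : Set a} where

  Unique-lookup-injective : ∀ {xs : List A} → Unique xs →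
                            ∀ i j → List.lookup xs i ≡ List.lookup xs j → i ≡ j
  Unique-lookup-injective (_  ∷ _) zero    zero    _  = refl
  Unique-lookup-injective (x∉ ∷ _) zero    (suc j) eq = ⊥-elim (All.lookup x∉ (∈-lookup j) eq)
  Unique-lookup-injective (x∉ ∷ _) (suc i) zero    eq = ⊥-elim (All.lookup x∉ (∈-lookup i) (sym eq))
  Unique-lookup-injective (_  ∷ u) (suc i) (suc j) eq = cong suc (Unique-lookup-injective u i j eq)

  Unique-++⁻ˡ : ∀ xs {ys : List A} → Unique (xs ++ ys) → Unique xs
  Unique-++⁻ˡ []       _         = []
  Unique-++⁻ˡ (x ∷ xs) (x∉ ∷ u) = ++⁻ˡ xs x∉ ∷ Unique-++⁻ˡ xs u

  Unique-reverse : ∀ {xs : List A} → Unique xs → Unique (reverse xs)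
  Unique-reverse {xs} = Unique-resp-↭ (setoid A) (↭-sym (setoid A) (↭-reverse (setoid A) xs))

injection⇒length≤ : ∀ {a b p} {A : Set a} {B : Set b} {P : A → Set p} {xs : List A} (ys : List B)
  (f : ∀ x → P x → B) → (∀ x px → f x px ∈ ys) → (∀ x y px py → f x px ≡ f y py → x ≡ y) →
  Unique xs → All P xs → length xs ≤ length ys
injection⇒length≤ {B = B} ys f f∈ys f-injective unique pxs = injective⇒≤ position-injective
  where
  position : Fin _ → Fin (length ys)
  position i = index (f∈ys _ (All.lookup pxs (∈-lookup i)))
  position-injective : Injective _≡_ _≡_ position
  position-injective eq = Unique-lookup-injective unique _ _
    (f-injective _ _ _ _ (index-injective (setoid B) (f∈ys _ _) (f∈ys _ _) eq))

length-cartesianProductWith : ∀ {a b c} {A : Set a} {B : Set b} {C : Set c} (f : A → B → C) xs ys →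
                              length (cartesianProductWith f xs ys) ≡ length xs * length ys
length-cartesianProductWith f []       ys = refl
length-cartesianProductWith f (x ∷ xs) ys =
  trans (length-++ (List.map (f x) ys)) (cong₂ _+_ (length-map (f x) ys) (length-cartesianProductWith f xs ys))

module _ {a} {A : Set a} where

  choices : ∀ {k} → (Fin k → List A) → List (Vec A k)
  choices {zero}  _  = [ Vec.[] ]
  choices {suc k} as = cartesianProductWith Vec._∷_ (as zero) (choices (as ∘ suc))

  length-choices : ∀ {k} (as : Fin k → List A) → length (choices as) ≡ product (length ∘ as)
  length-choices {zero}  as = refl
  length-choices {suc k} as = trans (length-cartesianProductWith Vec._∷_ (as zero) _)
                                    (cong (length (as zero) *_) (length-choices (as ∘ suc)))

  ∈-choices : ∀ {k} (as : Fin k → List A) (v : Vec A k) → (∀ i → lookup v i ∈ as i) → v ∈ choices as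
  ∈-choices as Vec.[]      _  = here refl
  ∈-choices as (x Vec.∷ v) v∈ =
    ∈-cartesianProductWith⁺ Vec._∷_ (v∈ zero) (∈-choices (as ∘ suc) v (v∈ ∘ suc))

indicator : Bool → ℕ
indicator true  = 1
indicator false = 0

support : ∀ {n} → (Fin n → Bool) → List (Fin n)
support {zero}  b = []
support {suc n} b with b zero
... | true  = zero ∷ List.map suc (support (b ∘ suc))
... | false = List.map suc (support (b ∘ suc))

length-support : ∀ {n} (b : Fin n → Bool) → length (support b) ≡ sum (indicator ∘ b)
length-support {zero}  b = refl
length-support {suc n} b with b zero
... | true  = cong suc (trans (length-map suc (support (b ∘ suc))) (length-support (b ∘ suc)))
... | false = trans (length-map suc (support (b ∘ suc))) (length-support (b ∘ suc))

∈-support : ∀ {n} (b : Fin n → Bool) {i} → b i ≡ true → i ∈ support b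
∈-support {suc n} b {zero}  bi with b zero
... | true  = here refl
∈-support {suc n} b {suc i} bi with b zero
... | true  = there (∈-map⁺ suc (∈-support (b ∘ suc) bi))
... | false = ∈-map⁺ suc (∈-support (b ∘ suc) bi)

-- Walks and cycles

module _ {A : Set} where

  data Path (E : A → A → Set) : A → List A → A → Set where
    [-] : ∀ {x} → Path E x [ x ] x
    _∷_ : ∀ {x y xs z} → E x y → Path E y xs z → Path E x (x ∷ xs) z

  module _ {E : A → A → Set} where

    _++ᵖ_ : ∀ {x y z xs ys} → Path E x xs y → Path E y (y ∷ ys) z → Path E x (xs ++ ys) z
    [-]     ++ᵖ q = q
    (e ∷ p) ++ᵖ q = e ∷ (p ++ᵖ q)

    reverseᵖ : (∀ {x y} → E x y → E y x) → ∀ {x y xs} → Path E x xs y → Path E y (reverse xs) x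
    reverseᵖ E-sym [-]                       = [-]
    reverseᵖ E-sym (_∷_ {x} {xs = xs} e p) =
      subst (λ l → Path E _ l x) (sym (unfold-reverse x xs)) (reverseᵖ E-sym p ++ᵖ (E-sym e ∷ [-]))

    prefixᵖ : ∀ xs {x y z ys} → Path E x (xs ++ y ∷ ys) z → Path E x (xs ++ [ y ]) y
    prefixᵖ []           [-]     = [-]
    prefixᵖ []           (_ ∷ _) = [-]
    prefixᵖ (_ ∷ [])     (e ∷ p) = e ∷ prefixᵖ [] p
    prefixᵖ (_ ∷ _ ∷ xs) (e ∷ p) = e ∷ prefixᵖ (_ ∷ xs) p

    mapᵖ : ∀ {F : A → A → Set} → (∀ {x y} → E x y → F x y) →
           ∀ {x y xs} → Path E x xs y → Path F x xs y
    mapᵖ E⇒F [-]     = [-]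
    mapᵖ E⇒F (e ∷ p) = E⇒F e ∷ mapᵖ E⇒F p

    head≡ᵖ : ∀ {x y w xs} → Path E x (w ∷ xs) y → w ≡ x
    head≡ᵖ [-]     = refl
    head≡ᵖ (_ ∷ _) = refl

    first-stepᵖ : ∀ {x y v w xs} → Path E x (v ∷ w ∷ xs) y → E x w
    first-stepᵖ (e ∷ [-])     = e
    first-stepᵖ (e ∷ (_ ∷ _)) = e

    last∈ᵖ : ∀ {x y xs} → Path E x xs y → y ∈ xs
    last∈ᵖ [-]     = here refl
    last∈ᵖ (_ ∷ p) = there (last∈ᵖ p)

    stepᵖ : ∀ {x y w xs} → Path E x (w ∷ xs) y → ∀ (i : Fin (length xs)) →
            E (List.lookup (w ∷ xs) (inject₁ i)) (List.lookup (w ∷ xs) (suc i))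
    stepᵖ (e ∷ [-])       zero    = e
    stepᵖ (e ∷ (_ ∷ _))   zero    = e
    stepᵖ (_ ∷ p@(_ ∷ _)) (suc i) = stepᵖ p i

    lastᵖ : ∀ {x y w xs} → Path E x (w ∷ xs) y → List.lookup (w ∷ xs) (fromℕ (length xs)) ≡ y
    lastᵖ [-]             = refl
    lastᵖ (_ ∷ [-])       = refl
    lastᵖ (_ ∷ p@(_ ∷ _)) = lastᵖ p

    module _ (h : A → ℕ) (E-decreasing : ∀ {x y} → E x y → h y < h x) where

      Path-h≤ : ∀ {x y xs} → Path E x xs y → All (λ v → h v ≤ h x) xs
      Path-h≤ [-]     = ≤-refl ∷ []
      Path-h≤ (e ∷ p) = ≤-refl ∷ All.map (λ hv≤ → ≤-trans hv≤ (<⇒≤ (E-decreasing e))) (Path-h≤ p)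

      Path-unique : ∀ {x y xs} → Path E x xs y → Unique xs
      Path-unique [-]     = [] ∷ []
      Path-unique (e ∷ p) =
        All.map (λ hv≤ x≡v → <⇒≱ (E-decreasing e) (subst (λ v → h v ≤ _) (sym x≡v) hv≤))
                (Path-h≤ p)
        ∷ Path-unique p

closedPath⇒cycle : ∀ {n} {G : Graph n} {x y xs} → Path (Adj G) x xs y → Adj G y x →
                   Unique xs → 3 ≤ length xs → Cycle G (length xs ∸ 3)
closedPath⇒cycle {G = G} {xs = xs@(_ ∷ _ ∷ _ ∷ _)} p yx unique (s≤s (s≤s (s≤s _))) =
  List.lookup xs , (λ {i} {j} → Unique-lookup-injective unique i j) , stepᵖ p ,
  subst₂ (Adj G) (sym (lastᵖ p)) (sym (head≡ᵖ p)) yx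

module _ {n} {G : Graph n} (simple : Simple G)
         {E : Fin n → Fin n → Set} (E⇒Adj : ∀ {x y} → E x y → Adj G x y) where

  private
    Adj-sym : ∀ {x y} → Adj G x y → Adj G y x
    Adj-sym = proj₁ simple _ _

  2≤length-branches : ∀ {i j c d S S'} P Q → Adj G i j → ¬ E i j → ¬ E j i →
                      Path E i (P ++ d ∷ S) c → Path E j (Q ++ d ∷ S') c → 2 ≤ length P + length Q
  2≤length-branches [] [] ij _ _ p q =
    ⊥-elim (proj₂ simple _ (subst (Adj G _) (trans (sym (head≡ᵖ q)) (head≡ᵖ p)) ij))
  2≤length-branches [] (_ ∷ []) _ _ ¬Eji p q = ⊥-elim (¬Eji (subst (E _) (head≡ᵖ p) (first-stepᵖ q)))
  2≤length-branches (_ ∷ []) [] _ ¬Eij _ p q = ⊥-elim (¬Eij (subst (E _) (head≡ᵖ q) (first-stepᵖ p)))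
  2≤length-branches [] (_ ∷ _ ∷ _) _ _ _ _ _ = s≤s (s≤s z≤n)
  2≤length-branches (_ ∷ []) (_ ∷ _) _ _ _ _ _ = s≤s (s≤s z≤n)
  2≤length-branches (_ ∷ _ ∷ _) _ _ _ _ _ _ = s≤s (s≤s z≤n)

  -- The cycle follows xs from i up to its first vertex d on ys, then ys backwards from d to j.
  paths⇒cycle : ∀ {i j c xs ys} → Adj G i j → ¬ E i j → ¬ E j i →
                Path E i xs c → Path E j ys c → Unique xs → Unique ys → ∃ (Cycle G)
  paths⇒cycle {i} {j} {ys = ys} ij ¬Eij ¬Eji pxs pys uxs uys
    with toView (¬All⇒First (λ x → ¬? (_∈?_ _≟ᶠ_ x ys)) (decidable-stable (_∈?_ _≟ᶠ_ _ ys))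
                            (λ all∉ → All.lookup all∉ (last∈ᵖ pxs) (last∈ᵖ pys)))
  ... | First._++_∷_ {P} {d} P∉ys d∈ys S with ∈-∃++ d∈ys
  ...   | Q , S' , refl = _ , closedPath⇒cycle {G = G} path (Adj-sym ij) unique long
    where
    left : Path (Adj G) i (P ++ [ d ]) d
    left = prefixᵖ P (mapᵖ E⇒Adj pxs)
    right : Path (Adj G) d (d ∷ reverse Q) j
    right = subst (λ l → Path (Adj G) d l j) (reverse-++ Q [ d ])
                  (reverseᵖ Adj-sym (prefixᵖ Q (mapᵖ E⇒Adj pys)))
    path : Path (Adj G) i (P ++ d ∷ reverse Q) j
    path = subst (λ l → Path (Adj G) i l j) (++-assoc P [ d ] (reverse Q)) (left ++ᵖ right)

    right⊆ys : ∀ {v} → v ∈ d ∷ reverse Q → v ∈ Q ++ d ∷ S'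
    right⊆ys (here refl) = ∈-++⁺ʳ Q (here refl)
    right⊆ys (there v∈)  = ∈-++⁺ˡ (reverse⁻ {xs = Q} v∈)
    right-unique : Unique (d ∷ reverse Q)
    right-unique = subst Unique (reverse-++ Q [ d ])
      (Unique-reverse (Unique-++⁻ˡ (Q ++ [ d ]) (subst Unique (sym (++-assoc Q [ d ] S')) uys)))
    unique : Unique (P ++ d ∷ reverse Q)
    unique = Unique.++⁺ (Unique-++⁻ˡ P uxs) right-unique
                        (λ (v∈P , v∈right) → All.lookup P∉ys v∈P (right⊆ys v∈right))

    length≡ : length (P ++ d ∷ reverse Q) ≡ suc (length P + length Q)
    length≡ = trans (length-++ P) (trans (cong (λ k → length P + suc k) (length-reverse Q))
                                         (+-suc (length P) (length Q)))
    long : 3 ≤ length (P ++ d ∷ reverse Q)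
    long = subst (3 ≤_) (sym length≡) (s≤s (2≤length-branches P Q ij ¬Eij ¬Eji pxs pys))

-- Spanning trees

module _ {P : ℕ → Set} (P? : ∀ k → Dec (P k)) where

  Least : Set
  Least = ∃[ k ] P k × (∀ {j} → P j → k ≤ j)

  least : ∀ {n} → P n → Least
  least {n} pn = search 0 n refl (λ ())
    where
    search : ∀ i d → i + d ≡ n → (∀ {j} → j < i → ¬ P j) → Least
    search i zero i+0≡n below =
      i , subst P (trans (sym i+0≡n) (+-identityʳ i)) pn , λ pj → ≮⇒≥ (λ j<i → below j<i pj)
    search i (suc d) i+d≡n below with P? i
    ... | yes pi = i , pi , λ pj → ≮⇒≥ (λ j<i → below j<i pj)
    ... | no ¬pi = search (suc i) d (trans (sym (+-suc i d)) i+d≡n) below′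
      where
      below′ : ∀ {j} → j < suc i → ¬ P j
      below′ j<1+i with m<1+n⇒m<n∨m≡n j<1+i
      ... | inj₁ j<i  = below j<i
      ... | inj₂ refl = ¬pi

adjacent : ∀ {n} → Graph n → Fin n → Fin n → Bool
adjacent G u v = lookup (lookup G u) v

degree : ∀ {n} → Graph n → Fin n → ℕ
degree G v = sum (indicator ∘ adjacent G v)

neighbours : ∀ {n} → Graph n → Fin n → List (Fin n)
neighbours G v = support (adjacent G v)

Adj-ext : ∀ {n} {T T' : Graph n} →
          (∀ {i j} → Adj T i j → Adj T' i j) → (∀ {i j} → Adj T' i j → Adj T i j) → T ≡ T'
Adj-ext T⊆T' T'⊆T =
  Pointwise-≡⇒≡ (ext λ i → Pointwise-≡⇒≡ (ext λ j → ⇔→≡ (mk⇔ T⊆T' T'⊆T)))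

record ParentMap {n} (T : Graph n) (r : Fin n) : Set where
  field
    parent          : Fin n → Fin n
    depth           : Fin n → ℕ
    parent-root     : parent r ≡ r
    depth-root      : depth r ≡ 0
    depth≡0⇒root    : ∀ {v} → depth v ≡ 0 → v ≡ r
    parent-adjacent : ∀ {v} → v ≢ r → Adj T v (parent v)
    depth-parent    : ∀ {v} → v ≢ r → depth v ≡ suc (depth (parent v))

  ParentStep : Fin n → Fin n → Set
  ParentStep u w = u ≢ r × parent u ≡ w

  ParentStep? : ∀ u w → Dec (ParentStep u w)
  ParentStep? u w = ¬? (u ≟ᶠ r) ×-dec (parent u ≟ᶠ w)

  ParentStep⇒Adj : ∀ {u w} → ParentStep u w → Adj T u w
  ParentStep⇒Adj (u≢r , refl) = parent-adjacent u≢r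

  ParentStep-decreasing : ∀ {u w} → ParentStep u w → depth w < depth u
  ParentStep-decreasing (u≢r , refl) = ≤-reflexive (sym (depth-parent u≢r))

  pathToRoot : ∀ v → ∃[ xs ] Path ParentStep v xs r
  pathToRoot v = climb (depth v) v refl
    where
    climb : ∀ k v → depth v ≡ k → ∃[ xs ] Path ParentStep v xs r
    climb zero    v depth≡0 rewrite depth≡0⇒root depth≡0 = _ , [-]
    climb (suc k) v depth≡1+k =
      _ , (v≢r , refl) ∷ proj₂ (climb k (parent v) depth≡k)
      where
      v≢r : v ≢ r
      v≢r refl = 0≢1+n (trans (sym depth-root) depth≡1+k)
      depth≡k : depth (parent v) ≡ k
      depth≡k = suc-injective (trans (sym (depth-parent v≢r)) depth≡1+k)

  module _ (simple : Simple T) (acyclic : Acyclic T) where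

    Adj⇒ParentStep : ∀ {i j} → Adj T i j → ParentStep i j ⊎ ParentStep j i
    Adj⇒ParentStep {i} {j} ij with ParentStep? i j | ParentStep? j i
    ... | yes i↑j | _       = inj₁ i↑j
    ... | no _    | yes j↑i = inj₂ j↑i
    ... | no ¬i↑j | no ¬j↑i =
      let (m , cycle) = paths⇒cycle {G = T} simple ParentStep⇒Adj ij ¬i↑j ¬j↑i pi pj (unique pi) (unique pj)
      in ⊥-elim (acyclic m cycle)
      where
      pi = proj₂ (pathToRoot i)
      pj = proj₂ (pathToRoot j)
      unique = Path-unique depth ParentStep-decreasing

module BreadthFirst {n} (T : Graph n) (r : Fin n) (T-sym : ∀ {u v} → Adj T u v → Adj T v u)
                    (reachable : ∀ v → Star (Adj T) r v) where

  Reach : ℕ → Fin n → Set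
  Reach zero    v = v ≡ r
  Reach (suc k) v = Reach k v ⊎ ∃[ u ] Reach k u × Adj T u v

  reach? : ∀ k v → Dec (Reach k v)
  reach? zero    v = v ≟ᶠ r
  reach? (suc k) v = reach? k v ⊎-dec any? (λ u → reach? k u ×-dec (adjacent T u v ≟ᵇ true))

  Star⇒Reach : ∀ {k u v} → Reach k u → Star (Adj T) u v → ∃[ K ] Reach K v
  Star⇒Reach {k}     ru ε         = k , ru
  Star⇒Reach {k} {u} ru (uw ◅ wv) = Star⇒Reach {suc k} (inj₂ (u , ru , uw)) wv

  distance : ∀ v → Least (λ k → reach? k v)
  distance v = let (_ , reach) = Star⇒Reach {0} refl (reachable v) in least (λ k → reach? k v) reach

  depth : Fin n → ℕ
  depth v = proj₁ (distance v)

  reach-depth : ∀ v → Reach (depth v) v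
  reach-depth v = proj₁ (proj₂ (distance v))

  depth-minimal : ∀ v {k} → Reach k v → depth v ≤ k
  depth-minimal v = proj₂ (proj₂ (distance v))

  predecessor : ∀ v → v ≢ r → ∃[ u ] Adj T u v × depth v ≡ suc (depth u)
  predecessor v v≢r with depth v | reach-depth v | depth-minimal v
  ... | zero  | v≡r                     | _       = ⊥-elim (v≢r v≡r)
  ... | suc k | inj₁ reach-k            | minimal = ⊥-elim (1+n≰n (minimal reach-k))
  ... | suc k | inj₂ (u , reach-u , uv) | minimal =
    u , uv , cong suc (≤-antisym (≤-pred (minimal (inj₂ (u , reach-depth u , uv)))) (depth-minimal u reach-u))

  parent : Fin n → Fin n
  parent v with v ≟ᶠ r
  ... | yes _   = r
  ... | no v≢r = proj₁ (predecessor v v≢r)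

  parentMap : ParentMap T r
  parentMap = record
    { parent          = parent
    ; depth           = depth
    ; parent-root     = parent-root
    ; depth-root      = n≤0⇒n≡0 (depth-minimal r refl)
    ; depth≡0⇒root    = λ {v} depth≡0 → subst (λ k → Reach k v) depth≡0 (reach-depth v)
    ; parent-adjacent = parent-adjacent
    ; depth-parent    = depth-parent
    }
    where
    parent-root : parent r ≡ r
    parent-root with r ≟ᶠ r
    ... | yes _   = refl
    ... | no r≢r = ⊥-elim (r≢r refl)
    parent-adjacent : ∀ {v} → v ≢ r → Adj T v (parent v)
    parent-adjacent {v} v≢r with v ≟ᶠ r
    ... | yes v≡r  = ⊥-elim (v≢r v≡r)
    ... | no v≢r′ = T-sym (proj₁ (proj₂ (predecessor v v≢r′)))
    depth-parent : ∀ {v} → v ≢ r → depth v ≡ suc (depth (parent v))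
    depth-parent {v} v≢r with v ≟ᶠ r
    ... | yes v≡r  = ⊥-elim (v≢r v≡r)
    ... | no v≢r′ = proj₂ (proj₂ (predecessor v v≢r′))

module SpanningTreeCount {n} (G : Graph n) (r : Fin n) where

  parentMap : ∀ T → IsSpanningTree G T → ParentMap T r
  parentMap T ((T-sym , _) , _ , connected , _) = BreadthFirst.parentMap T r (T-sym _ _) (connected r)

  parentCode : ∀ T → IsSpanningTree G T → Vec (Fin n) n
  parentCode T t = tabulate (ParentMap.parent (parentMap T t))

  same-parents⇒⊆ : ∀ T T' (t : IsSpanningTree G T) (t' : IsSpanningTree G T') →
    (∀ v → ParentMap.parent (parentMap T t) v ≡ ParentMap.parent (parentMap T' t') v) →
    ∀ {i j} → Adj T i j → Adj T' i j
  same-parents⇒⊆ T T' t@(simple , _ , _ , acyclic) t'@((T'-sym , _) , _) same {i} {j} ij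
    with ParentMap.Adj⇒ParentStep (parentMap T t) simple acyclic ij
  ... | inj₁ (i≢r , refl) = subst (Adj T' i) (sym (same i)) (ParentMap.parent-adjacent (parentMap T' t') i≢r)
  ... | inj₂ (j≢r , refl) =
    T'-sym _ _ (subst (Adj T' j) (sym (same j)) (ParentMap.parent-adjacent (parentMap T' t') j≢r))

  parentCode-injective : ∀ T T' (t : IsSpanningTree G T) (t' : IsSpanningTree G T') →
                         parentCode T t ≡ parentCode T' t' → T ≡ T'
  parentCode-injective T T' t t' eq =
    Adj-ext (same-parents⇒⊆ T T' t t' same) (same-parents⇒⊆ T' T t' t (sym ∘ same))
    where
    same : ∀ v → ParentMap.parent (parentMap T t) v ≡ ParentMap.parent (parentMap T' t') v
    same v = trans (sym (lookup∘tabulate _ v)) (trans (cong (λ c → lookup c v) eq) (lookup∘tabulate _ v))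

  parentChoices : Fin n → List (Fin n)
  parentChoices v with v ≟ᶠ r
  ... | yes _ = [ r ]
  ... | no _  = neighbours G v

  length-parentChoices : ∀ v → length (parentChoices v) ≤ degree G v ⊔ 1
  length-parentChoices v with v ≟ᶠ r
  ... | yes _ = m≤n⊔m (degree G v) 1
  ... | no _  = ≤-trans (≤-reflexive (length-support (adjacent G v))) (m≤m⊔n (degree G v) 1)

  ∈-parentChoices : ∀ {T} → T ⊆G G → ∀ v {u} → (v ≡ r → u ≡ r) → (v ≢ r → Adj T v u) →
                    u ∈ parentChoices v
  ∈-parentChoices T⊆G v root non-root with v ≟ᶠ r
  ... | yes v≡r = here (root v≡r)
  ... | no v≢r  = ∈-support (adjacent G v) (T⊆G _ _ (non-root v≢r))

  parentCode∈choices : ∀ T (t : IsSpanningTree G T) → parentCode T t ∈ choices parentChoices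
  parentCode∈choices T t@(_ , T⊆G , _) = ∈-choices parentChoices (parentCode T t) λ v →
    subst (_∈ parentChoices v) (sym (lookup∘tabulate _ v))
          (∈-parentChoices {T} T⊆G v (λ { refl → parent-root }) parent-adjacent)
    where open ParentMap (parentMap T t)

  spanningTrees≤ : ∀ ts → Unique ts → All (IsSpanningTree G) ts →
                   length ts ≤ product (λ v → degree G v ⊔ 1)
  spanningTrees≤ ts unique trees = begin
    length ts                         ≤⟨ injection⇒length≤ (choices parentChoices) parentCode
                                           parentCode∈choices parentCode-injective unique trees ⟩
    length (choices parentChoices)    ≡⟨ length-choices parentChoices ⟩
    product (length ∘ parentChoices)  ≤⟨ product-mono-≤ length-parentChoices ⟩
    product (λ v → degree G v ⊔ 1)    ∎
    where open ≤-Reasoning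

-- Graphs without C₄

indicator-∧ : ∀ x y → indicator (x ∧ y) ≡ indicator x * indicator y
indicator-∧ true  y = sym (+-identityʳ (indicator y))
indicator-∧ false y = refl

sum-indicator≤1 : ∀ {n} (b : Fin n → Bool) → (∀ {i j} → b i ≡ true → b j ≡ true → i ≡ j) →
                  sum (indicator ∘ b) ≤ 1
sum-indicator≤1 {zero}  b at-most-one = z≤n
sum-indicator≤1 {suc n} b at-most-one with b zero in b₀
... | false = sum-indicator≤1 (b ∘ suc) (λ bi bj → suc-injectiveᶠ (at-most-one bi bj))
... | true  = ≤-reflexive (cong suc (trans (sum-cong-≗ rest≡0) (trans (sum-const n 0) (*-zeroʳ n))))
  where
  rest≡0 : ∀ i → indicator (b (suc i)) ≡ 0
  rest≡0 i with b (suc i) in bᵢ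
  ... | false = refl
  ... | true  with () ← at-most-one b₀ bᵢ

module _ {n} {G : Graph n} (simple : Simple G) (c4free : C4Free G) where

  codegree : Fin n → Fin n → ℕ
  codegree a b = sum (λ v → indicator (adjacent G v a ∧ adjacent G v b))

  private
    Adj⇒≢ : ∀ {x y} → Adj G x y → x ≢ y
    Adj⇒≢ {x} xy refl = proj₂ simple x xy

    Adj-sym : ∀ {x y} → Adj G x y → Adj G y x
    Adj-sym = proj₁ simple _ _

  common-neighbour-unique : ∀ {a b v w} → a ≢ b →
                            Adj G v a → Adj G v b → Adj G w a → Adj G w b → v ≡ w
  common-neighbour-unique {a} {b} {v} {w} a≢b va vb wa wb with v ≟ᶠ w
  ... | yes v≡w = v≡w
  ... | no v≢w  = ⊥-elim (c4free (closedPath⇒cycle {G = G} (Adj-sym va ∷ vb ∷ Adj-sym wb ∷ [-]) wa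
                                                    distinct (s≤s (s≤s (s≤s z≤n)))))
    where
    distinct : Unique (a ∷ v ∷ b ∷ w ∷ [])
    distinct = (≢-sym (Adj⇒≢ va) ∷ a≢b ∷ ≢-sym (Adj⇒≢ wa) ∷ [])
             ∷ (Adj⇒≢ vb ∷ v≢w ∷ []) ∷ (≢-sym (Adj⇒≢ wb) ∷ []) ∷ [] ∷ []

  codegree≤1 : ∀ {a b} → a ≢ b → codegree a b ≤ 1
  codegree≤1 a≢b = sum-indicator≤1 _ λ v∈ w∈ →
    common-neighbour-unique a≢b (∧-conicalˡ _ _ v∈) (∧-conicalʳ _ _ v∈)
                                (∧-conicalˡ _ _ w∈) (∧-conicalʳ _ _ w∈)

  degree² : ∀ v → degree G v * degree G v ≡
                  sum (λ a → sum (λ b → indicator (adjacent G v a ∧ adjacent G v b)))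
  degree² v = begin
    degree G v * degree G v
      ≡⟨ *-distribʳ-sum (degree G v) (indicator ∘ adjacent G v) ⟩
    sum (λ a → indicator (adjacent G v a) * degree G v)
      ≡⟨ sum-cong-≗ (λ a → *-distribˡ-sum (indicator (adjacent G v a)) (indicator ∘ adjacent G v)) ⟩
    sum (λ a → sum (λ b → indicator (adjacent G v a) * indicator (adjacent G v b)))
      ≡⟨ sum-cong-≗ (λ a → sum-cong-≗ (λ b → sym (indicator-∧ (adjacent G v a) (adjacent G v b)))) ⟩
    sum (λ a → sum (λ b → indicator (adjacent G v a ∧ adjacent G v b)))
      ∎
    where open ≡-Reasoning

  ∑degree²≡∑∑codegree : sum (λ v → degree G v * degree G v) ≡ sum (λ a → sum (codegree a))
  ∑degree²≡∑∑codegree = begin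
    sum (λ v → degree G v * degree G v)
      ≡⟨ sum-cong-≗ degree² ⟩
    sum (λ v → sum (λ a → sum (λ b → indicator (adjacent G v a ∧ adjacent G v b))))
      ≡⟨ ∑-comm (λ v a → sum (λ b → indicator (adjacent G v a ∧ adjacent G v b))) ⟩
    sum (λ a → sum (λ v → sum (λ b → indicator (adjacent G v a ∧ adjacent G v b))))
      ≡⟨ sum-cong-≗ (λ a → ∑-comm (λ v b → indicator (adjacent G v a ∧ adjacent G v b))) ⟩
    sum (λ a → sum (codegree a))
      ∎
    where open ≡-Reasoning

  ∑codegree-diagonal : sum (λ a → codegree a a) ≡ sum (degree G)
  ∑codegree-diagonal = begin
    sum (λ a → codegree a a)
      ≡⟨ sum-cong-≗ (λ a → sum-cong-≗ (λ v → cong indicator (∧-idem (adjacent G v a)))) ⟩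
    sum (λ a → sum (λ v → indicator (adjacent G v a)))
      ≡⟨ ∑-comm (λ a v → indicator (adjacent G v a)) ⟩
    sum (degree G)
      ∎
    where open ≡-Reasoning

  ∑degree²≤ : sum (λ v → degree G v * degree G v) + n ≤ sum (degree G) + n * n
  ∑degree²≤ = begin
    sum (λ v → degree G v * degree G v) + n
      ≡⟨ cong₂ _+_ ∑degree²≡∑∑codegree (sym (trans (sum-const n 1) (*-identityʳ n))) ⟩
    sum (λ a → sum (codegree a)) + sum {n} (λ _ → 1)
      ≡⟨ ∑-distrib-+ (λ a → sum (codegree a)) (λ _ → 1) ⟨
    sum (λ a → sum (codegree a) + 1)
      ≤⟨ sum-mono-≤ (λ a → sum-≤-diagonal a (codegree a) (λ b b≢a → codegree≤1 (≢-sym b≢a))) ⟩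
    sum (λ a → codegree a a + n)
      ≡⟨ ∑-distrib-+ (λ a → codegree a a) (λ _ → n) ⟩
    sum (λ a → codegree a a) + sum {n} (λ _ → n)
      ≡⟨ cong₂ _+_ ∑codegree-diagonal (sum-const n n) ⟩
    sum (degree G) + n * n
      ∎
    where open ≤-Reasoning

-- Inequalities

⊔1-square : ∀ d → (d ⊔ 1) * (d ⊔ 1) + d ≡ d * d + (d ⊔ 1)
⊔1-square zero    = refl
⊔1-square (suc d) rewrite ⊔-identityʳ d = refl

-- `List ℕ ∋` fixes the type of the solver's variable list, as `_∷_` is overloaded here.
+-≤-balance : ∀ {n N a b c e} → a + b ≡ c + e → c + n ≤ b + N → a + n ≤ e + N
+-≤-balance {n} {N} {a} {b} {c} {e} a+b≡c+e c+n≤b+N = +-cancelʳ-≤ b _ _ (begin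
  a + n + b   ≡⟨ solve (List ℕ ∋ a ∷ b ∷ n ∷ []) ⟩
  a + b + n   ≡⟨ cong (_+ n) a+b≡c+e ⟩
  c + e + n   ≡⟨ solve (List ℕ ∋ c ∷ e ∷ n ∷ []) ⟩
  c + n + e   ≤⟨ +-monoˡ-≤ e c+n≤b+N ⟩
  b + N + e   ≡⟨ solve (List ℕ ∋ b ∷ e ∷ N ∷ []) ⟩
  e + N + b   ∎)
  where open ≤-Reasoning

∑[d⊔1]²≤ : ∀ {n} (d : Fin n → ℕ) {N} → sum (λ v → d v * d v) + n ≤ sum d + N →
           sum (λ v → (d v ⊔ 1) * (d v ⊔ 1)) + n ≤ sum (λ v → d v ⊔ 1) + N
∑[d⊔1]²≤ {n} d {N} = +-≤-balance {n} {N} (begin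
  sum (λ v → (d v ⊔ 1) * (d v ⊔ 1)) + sum d    ≡⟨ ∑-distrib-+ (λ v → (d v ⊔ 1) * (d v ⊔ 1)) d ⟨
  sum (λ v → (d v ⊔ 1) * (d v ⊔ 1) + d v)      ≡⟨ sum-cong-≗ (⊔1-square ∘ d) ⟩
  sum (λ v → d v * d v + (d v ⊔ 1))            ≡⟨ ∑-distrib-+ (λ v → d v * d v) (λ v → d v ⊔ 1) ⟩
  sum (λ v → d v * d v) + sum (λ v → d v ⊔ 1)  ∎)
  where open ≡-Reasoning

n≤n*n : ∀ n → n ≤ n * n
n≤n*n zero    = z≤n
n≤n*n (suc n) = m≤m*n (suc n) (suc n)

-- (x − q)(x − q − 1) ≥ 0
tangent : ∀ q x → (2 * q + 1) * x ≤ x * x + (q * q + q)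
tangent q x with ≤-total q x
... | inj₁ q≤x with (k , refl) ← m≤n⇒∃[o]m+o≡n q≤x = +-cancelʳ-≤ k _ _ (begin
  (2 * q + 1) * (q + k) + k            ≤⟨ +-monoʳ-≤ _ (n≤n*n k) ⟩
  (2 * q + 1) * (q + k) + k * k        ≡⟨ solve (List ℕ ∋ q ∷ k ∷ []) ⟩
  (q + k) * (q + k) + (q * q + q) + k  ∎)
  where open ≤-Reasoning
... | inj₂ x≤q with (k , refl) ← m≤n⇒∃[o]m+o≡n x≤q = begin
  (2 * (x + k) + 1) * x                   ≤⟨ m≤m+n _ (k * k + k) ⟩
  (2 * (x + k) + 1) * x + (k * k + k)     ≡⟨ solve (List ℕ ∋ x ∷ k ∷ []) ⟩
  x * x + ((x + k) * (x + k) + (x + k))   ∎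
  where open ≤-Reasoning

∑-tangent : ∀ {n} q (x : Fin n → ℕ) → (2 * q + 1) * sum x ≤ sum (λ v → x v * x v) + n * (q * q + q)
∑-tangent {n} q x = begin
  (2 * q + 1) * sum x                                ≡⟨ *-distribˡ-sum (2 * q + 1) x ⟩
  sum (λ v → (2 * q + 1) * x v)                      ≤⟨ sum-mono-≤ (tangent q ∘ x) ⟩
  sum (λ v → x v * x v + (q * q + q))                ≡⟨ ∑-distrib-+ (λ v → x v * x v) (λ _ → q * q + q) ⟩
  sum (λ v → x v * x v) + sum {n} (λ _ → q * q + q)  ≡⟨ cong (_ +_) (sum-const n (q * q + q)) ⟩
  sum (λ v → x v * x v) + n * (q * q + q)            ∎
  where open ≤-Reasoning

sum≤[1+q]*n : ∀ q .{{_ : NonZero q}} {S T} → let n = q * q + q + 1 in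
              T + n ≤ S + n * n → (2 * q + 1) * S ≤ T + n * (q * q + q) → S ≤ suc q * n
sum≤[1+q]*n q {S} {T} T+n≤S+n² tangent-sum = let n = q * q + q + 1 in
  *-cancelˡ-≤ (2 * q) {{m*n≢0 2 q}} (+-cancelʳ-≤ (S + n) _ _ (begin
    2 * q * S + (S + n)            ≡⟨ solve (List ℕ ∋ q ∷ S ∷ []) ⟩
    (2 * q + 1) * S + n            ≤⟨ +-monoˡ-≤ n tangent-sum ⟩
    T + n * (q * q + q) + n        ≡⟨ solve (List ℕ ∋ q ∷ T ∷ []) ⟩
    T + n + n * (q * q + q)        ≤⟨ +-monoˡ-≤ (n * (q * q + q)) T+n≤S+n² ⟩
    S + n * n + n * (q * q + q)    ≡⟨ solve (List ℕ ∋ q ∷ S ∷ []) ⟩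
    2 * q * (suc q * n) + (S + n)  ∎))
  where open ≤-Reasoning

-- secant m x says x/m ≤ (1 + 1/m)^(x − m) with the denominators cleared.  Both sides agree at
-- x = m, and each step of x away from m changes the left side by a factor no larger than the
-- factor 1 + 1/m applied to the right side.
module _ (m : ℕ) where

  private
    Secant : ℕ → Set
    Secant x = x * m ^ x * suc m ^ m ≤ m ^ suc m * suc m ^ x

    step-up : ∀ x A B C D → suc x * m ≤ x * suc m →
              x * A * B ≤ C * D → suc x * (m * A) * B ≤ C * (suc m * D)
    step-up x A B C D factor≤ ih = begin
      suc x * (m * A) * B    ≡⟨ solve (List ℕ ∋ x ∷ m ∷ A ∷ B ∷ []) ⟩
      (suc x * m) * (A * B)  ≤⟨ *-monoˡ-≤ (A * B) factor≤ ⟩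
      (x * suc m) * (A * B)  ≡⟨ solve (List ℕ ∋ x ∷ m ∷ A ∷ B ∷ []) ⟩
      suc m * (x * A * B)    ≤⟨ *-monoʳ-≤ (suc m) ih ⟩
      suc m * (C * D)        ≡⟨ solve (List ℕ ∋ m ∷ C ∷ D ∷ []) ⟩
      C * (suc m * D)        ∎
      where open ≤-Reasoning

    step-down : ∀ x A B C D → x * suc m ≤ suc x * m →
                suc x * (m * A) * B ≤ C * (suc m * D) → x * A * B ≤ C * D
    step-down x A B C D factor≤ ih = *-cancelˡ-≤ (suc m) (begin
      suc m * (x * A * B)    ≡⟨ solve (List ℕ ∋ x ∷ m ∷ A ∷ B ∷ []) ⟩
      (x * suc m) * (A * B)  ≤⟨ *-monoˡ-≤ (A * B) factor≤ ⟩
      (suc x * m) * (A * B)  ≡⟨ solve (List ℕ ∋ x ∷ m ∷ A ∷ B ∷ []) ⟩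
      suc x * (m * A) * B    ≤⟨ ih ⟩
      C * (suc m * D)        ≡⟨ solve (List ℕ ∋ m ∷ C ∷ D ∷ []) ⟩
      suc m * (C * D)        ∎)
      where open ≤-Reasoning

    ascend : ∀ k → Secant (m + k)
    ascend zero    = subst Secant (sym (+-identityʳ m)) ≤-refl
    ascend (suc k) = subst Secant (sym (+-suc m k))
      (step-up (m + k) (m ^ (m + k)) (suc m ^ m) (m ^ suc m) (suc m ^ (m + k))
        (subst (m + (m + k) * m ≤_) (sym (*-suc (m + k) m)) (+-monoˡ-≤ ((m + k) * m) (m≤m+n m k)))
        (ascend k))

    descend : ∀ k {x} → x + k ≡ m → Secant x
    descend zero    {x} x+0≡m = subst Secant (sym (trans (sym (+-identityʳ x)) x+0≡m)) ≤-refl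
    descend (suc k) {x} x+k≡m =
      step-down x (m ^ x) (suc m ^ m) (m ^ suc m) (suc m ^ x)
        (subst (_≤ m + x * m) (sym (*-suc x m)) (+-monoˡ-≤ (x * m) (subst (x ≤_) x+k≡m (m≤m+n x (suc k)))))
        (descend k (trans (sym (+-suc x k)) x+k≡m))

  secant : ∀ x → x * m ^ x * suc m ^ m ≤ m ^ suc m * suc m ^ x
  secant x with ≤-total m x
  ... | inj₁ m≤x = subst Secant (m+[n∸m]≡n m≤x) (ascend (x ∸ m))
  ... | inj₂ x≤m = descend (m ∸ x) (m+[n∸m]≡n x≤m)

-- AM–GM: multiply the secant bounds for all x v.
product≤pow : ∀ {n} m .{{_ : NonZero m}} (x : Fin n → ℕ) → sum x ≤ m * n → product x ≤ m ^ n
product≤pow {n} m x ∑x≤mn with (t , ∑x+t≡mn) ← m≤n⇒∃[o]m+o≡n ∑x≤mn =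
  cancel {{m^n≢0 m S}} {{m^n≢0 (suc m) S}} {{m^n≢0 (suc m) t}} (begin
    product x * m ^ S * (suc m ^ S * suc m ^ t)  ≡⟨ cong (product x * m ^ S *_) (^-distribˡ-+-* (suc m) S t) ⟨
    product x * m ^ S * suc m ^ (S + t)          ≡⟨ cong (λ k → product x * m ^ S * suc m ^ k) ∑x+t≡mn ⟩
    product x * m ^ S * suc m ^ (m * n)          ≡⟨ lhs ⟨
    product (λ v → x v * m ^ x v * suc m ^ m)    ≤⟨ product-mono-≤ (secant m ∘ x) ⟩
    product (λ v → m ^ suc m * suc m ^ x v)      ≡⟨ rhs ⟩
    m ^ (n + (S + t)) * suc m ^ S                ≡⟨ cong (_* suc m ^ S) (^-distribˡ-+-* m n (S + t)) ⟩
    m ^ n * m ^ (S + t) * suc m ^ S              ≡⟨ cong (λ k → m ^ n * k * suc m ^ S) (^-distribˡ-+-* m S t) ⟩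
    m ^ n * (m ^ S * m ^ t) * suc m ^ S
      ≤⟨ *-monoˡ-≤ (suc m ^ S) (*-monoʳ-≤ (m ^ n) (*-monoʳ-≤ (m ^ S) (^-monoˡ-≤ t (n≤1+n m)))) ⟩
    m ^ n * (m ^ S * suc m ^ t) * suc m ^ S      ∎)
  where
  open ≤-Reasoning
  S = sum x
  lhs : product (λ v → x v * m ^ x v * suc m ^ m) ≡ product x * m ^ S * suc m ^ (m * n)
  lhs = begin-equality
    product (λ v → x v * m ^ x v * suc m ^ m)
      ≡⟨ product-distrib-* (λ v → x v * m ^ x v) (λ _ → suc m ^ m) ⟩
    product (λ v → x v * m ^ x v) * product {n} (λ _ → suc m ^ m)
      ≡⟨ cong₂ _*_ (product-distrib-* x (λ v → m ^ x v)) (product-const n (suc m ^ m)) ⟩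
    product x * product (λ v → m ^ x v) * (suc m ^ m) ^ n
      ≡⟨ cong₂ (λ p q → product x * p * q) (product-pow m x) (^-*-assoc (suc m) m n) ⟩
    product x * m ^ S * suc m ^ (m * n)
      ∎
  rhs : product (λ v → m ^ suc m * suc m ^ x v) ≡ m ^ (n + (S + t)) * suc m ^ S
  rhs = begin-equality
    product (λ v → m ^ suc m * suc m ^ x v)
      ≡⟨ product-distrib-* (λ _ → m ^ suc m) (λ v → suc m ^ x v) ⟩
    product {n} (λ _ → m ^ suc m) * product (λ v → suc m ^ x v)
      ≡⟨ cong₂ _*_ (trans (product-const n (m ^ suc m)) (^-*-assoc m (suc m) n)) (product-pow (suc m) x) ⟩
    m ^ (n + m * n) * suc m ^ S
      ≡⟨ cong (λ k → m ^ (n + k) * suc m ^ S) ∑x+t≡mn ⟨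
    m ^ (n + (S + t)) * suc m ^ S
      ∎
  cancel : ∀ {P a b c e} .{{_ : NonZero a}} .{{_ : NonZero b}} .{{_ : NonZero c}} →
           P * a * (b * c) ≤ e * (a * c) * b → P ≤ e
  cancel {P} {a} {b} {c} {e} ineq = *-cancelʳ-≤ P e (a * b * c) {{m*n≢0 (a * b) c {{m*n≢0 a b}}}} (begin
    P * (a * b * c)  ≡⟨ solve (List ℕ ∋ P ∷ a ∷ b ∷ c ∷ []) ⟩
    P * a * (b * c)  ≤⟨ ineq ⟩
    e * (a * c) * b  ≡⟨ solve (List ℕ ∋ e ∷ a ∷ b ∷ c ∷ []) ⟩
    e * (a * b * c)  ∎)

-- (1 + 1/m)^k ≥ 1 + k/m + k(k − 1)/(2m²) with the denominators cleared.
binomial-lower : ∀ m k → m ^ k * (2 * m * m + 2 * k * m + k * k) ≤ 2 * m * m * suc m ^ k + m ^ k * k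
binomial-lower m zero    = ≤-reflexive (solve (List ℕ ∋ m ∷ []))
binomial-lower m (suc k) = step (m ^ k) (suc m ^ k) (binomial-lower m k)
  where
  open ≤-Reasoning
  poly : m * (2 * m * m + 2 * suc k * m + suc k * suc k) + suc m * k ≤
         suc m * (2 * m * m + 2 * k * m + k * k) + m * suc k
  poly = +-cancelʳ-≤ k _ _ (begin
    m * (2 * m * m + 2 * suc k * m + suc k * suc k) + suc m * k + k      ≤⟨ +-monoʳ-≤ _ (n≤n*n k) ⟩
    m * (2 * m * m + 2 * suc k * m + suc k * suc k) + suc m * k + k * k  ≡⟨ solve (List ℕ ∋ m ∷ k ∷ []) ⟩
    suc m * (2 * m * m + 2 * k * m + k * k) + m * suc k + k              ∎)
  step : ∀ B A → B * (2 * m * m + 2 * k * m + k * k) ≤ 2 * m * m * A + B * k →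
         m * B * (2 * m * m + 2 * suc k * m + suc k * suc k) ≤ 2 * m * m * (suc m * A) + m * B * suc k
  step B A ih = +-cancelʳ-≤ (suc m * (B * k)) _ _ (begin
    m * B * (2 * m * m + 2 * suc k * m + suc k * suc k) + suc m * (B * k)
      ≡⟨ solve (List ℕ ∋ m ∷ k ∷ B ∷ []) ⟩
    B * (m * (2 * m * m + 2 * suc k * m + suc k * suc k) + suc m * k)
      ≤⟨ *-monoʳ-≤ B poly ⟩
    B * (suc m * (2 * m * m + 2 * k * m + k * k) + m * suc k)
      ≡⟨ solve (List ℕ ∋ m ∷ k ∷ B ∷ []) ⟩
    suc m * (B * (2 * m * m + 2 * k * m + k * k)) + m * B * suc k
      ≤⟨ +-monoˡ-≤ (m * B * suc k) (*-monoʳ-≤ (suc m) ih) ⟩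
    suc m * (2 * m * m * A + B * k) + m * B * suc k
      ≡⟨ solve (List ℕ ∋ m ∷ k ∷ A ∷ B ∷ []) ⟩
    2 * m * m * (suc m * A) + m * B * suc k + suc m * (B * k)
      ∎)

12*m^m≤5*[1+m]^m : ∀ m → 5 ≤ m → 12 * m ^ m ≤ 5 * suc m ^ m
12*m^m≤5*[1+m]^m m 5≤m = bound (m ^ m) (suc m ^ m) (binomial-lower m m)
  where
  instance
    m≢0 : NonZero m
    m≢0 = >-nonZero (≤-trans (s≤s z≤n) 5≤m)
  bound : ∀ B A → B * (2 * m * m + 2 * m * m + m * m) ≤ 2 * m * m * A + B * m → 12 * B ≤ 5 * A
  bound B A binomial =
    *-cancelˡ-≤ (2 * m * m) {{m*n≢0 (2 * m) m {{m*n≢0 2 m}}}} (+-cancelʳ-≤ (5 * m * B) _ _ (begin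
    2 * m * m * (12 * B) + 5 * m * B           ≤⟨ +-monoʳ-≤ _ (*-monoˡ-≤ B (*-monoˡ-≤ m 5≤m)) ⟩
    2 * m * m * (12 * B) + m * m * B           ≡⟨ solve (List ℕ ∋ m ∷ B ∷ []) ⟩
    5 * (B * (2 * m * m + 2 * m * m + m * m))  ≤⟨ *-monoʳ-≤ 5 binomial ⟩
    5 * (2 * m * m * A + B * m)                ≡⟨ solve (List ℕ ∋ m ∷ A ∷ B ∷ []) ⟩
    2 * m * m * (5 * A) + 5 * m * B            ∎))
    where open ≤-Reasoning

12^j*m^[m*j]≤5^j*[1+m]^[m*j] : ∀ m j → 5 ≤ m → 12 ^ j * m ^ (m * j) ≤ 5 ^ j * suc m ^ (m * j)
12^j*m^[m*j]≤5^j*[1+m]^[m*j] m zero    5≤m rewrite *-zeroʳ m = ≤-refl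
12^j*m^[m*j]≤5^j*[1+m]^[m*j] m (suc j) 5≤m = begin
  12 * 12 ^ j * m ^ (m * suc j)              ≡⟨ cong (λ e → 12 * 12 ^ j * m ^ e) (*-suc m j) ⟩
  12 * 12 ^ j * m ^ (m + m * j)              ≡⟨ cong (12 * 12 ^ j *_) (^-distribˡ-+-* m m (m * j)) ⟩
  12 * 12 ^ j * (m ^ m * m ^ (m * j))        ≡⟨ *-interchange 12 (12 ^ j) (m ^ m) (m ^ (m * j)) ⟩
  12 * m ^ m * (12 ^ j * m ^ (m * j))
    ≤⟨ *-mono-≤ (12*m^m≤5*[1+m]^m m 5≤m) (12^j*m^[m*j]≤5^j*[1+m]^[m*j] m j 5≤m) ⟩
  5 * suc m ^ m * (5 ^ j * suc m ^ (m * j))  ≡⟨ *-interchange 5 (suc m ^ m) (5 ^ j) (suc m ^ (m * j)) ⟩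
  5 * 5 ^ j * (suc m ^ m * suc m ^ (m * j))  ≡⟨ cong (5 * 5 ^ j *_) (^-distribˡ-+-* (suc m) m (m * j)) ⟨
  5 * 5 ^ j * suc m ^ (m + m * j)            ≡⟨ cong (λ e → 5 * 5 ^ j * suc m ^ e) (*-suc m j) ⟨
  5 * 5 ^ j * suc m ^ (m * suc j)            ∎
  where open ≤-Reasoning

-- The added polynomial is 12 N(4 + t)² − 5 N(5 + t)², whose coefficients are all nonnegative.
ratio≤12/5 : ∀ q → 4 ≤ q → let N = λ k → k * k + k + 1 in
             5 * (N (suc q) * N (suc q)) ≤ 12 * (N q * N q)
ratio≤12/5 q 4≤q with (t , refl) ← m≤n⇒∃[o]m+o≡n 4≤q = let N = λ k → k * k + k + 1 in begin
  5 * (N (5 + t) * N (5 + t))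
    ≤⟨ m≤m+n _ (7 * (t * t * t * t) + 106 * (t * t * t) + 561 * (t * t) + 1126 * t + 487) ⟩
  5 * (N (5 + t) * N (5 + t)) + (7 * (t * t * t * t) + 106 * (t * t * t) + 561 * (t * t) + 1126 * t + 487)
    ≡⟨ solve (List ℕ ∋ t ∷ []) ⟩
  12 * (N (4 + t) * N (4 + t))
    ∎
  where open ≤-Reasoning

n²*5^j≤12^j : ∀ j → 13 ≤ j → let n = suc j * suc j + suc j + 1 in n * n * 5 ^ j ≤ 12 ^ j
n²*5^j≤12^j j 13≤j with m≤n⇒m<n∨m≡n 13≤j
... | inj₂ refl = from-yes (211 * 211 * 5 ^ 13 ≤? 12 ^ 13)
n²*5^j≤12^j (suc j) _ | inj₁ (s≤s 13≤j) = begin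
  n′² * (5 * 5 ^ j)  ≡⟨ *-assoc n′² 5 (5 ^ j) ⟨
  n′² * 5 * 5 ^ j    ≡⟨ cong (_* 5 ^ j) (*-comm n′² 5) ⟩
  5 * n′² * 5 ^ j    ≤⟨ *-monoˡ-≤ (5 ^ j) (ratio≤12/5 (suc j) 4≤1+j) ⟩
  12 * n² * 5 ^ j    ≡⟨ *-assoc 12 n² (5 ^ j) ⟩
  12 * (n² * 5 ^ j)  ≤⟨ *-monoʳ-≤ 12 (n²*5^j≤12^j j 13≤j) ⟩
  12 * 12 ^ j        ∎
  where
  open ≤-Reasoning
  N : ℕ → ℕ
  N q = q * q + q + 1
  n² n′² : ℕ
  n² = N (suc j) * N (suc j)
  n′² = N (suc (suc j)) * N (suc (suc j))
  4≤1+j : 4 ≤ suc j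
  4≤1+j = ≤-trans (s≤s (s≤s (s≤s (s≤s z≤n)))) (m≤n⇒m≤1+n 13≤j)

n²*[1+q]^q²≤[2+q]^q² : ∀ q → 14 ≤ q → let n = q * q + q + 1 in
                       n * n * suc q ^ (q * q) ≤ suc (suc q) ^ (q * q)
n²*[1+q]^q²≤[2+q]^q² (suc j) (s≤s 13≤j) = begin
  n * n * m ^ (q * q)        ≡⟨ cong (λ e → n * n * m ^ e) q²≡1+mj ⟩
  n * n * (m * m ^ (m * j))  ≤⟨ cancel {a = n * n} m {{m^n≢0 5 j}} (n²*5^j≤12^j j 13≤j)
                                                                   (12^j*m^[m*j]≤5^j*[1+m]^[m*j] m j 5≤m) ⟩
  suc m * suc m ^ (m * j)    ≡⟨ cong (suc m ^_) q²≡1+mj ⟨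
  suc m ^ (q * q)            ∎
  where
  open ≤-Reasoning
  q = suc j
  m = suc q
  n = q * q + q + 1
  5≤m : 5 ≤ m
  5≤m = ≤-trans (s≤s (s≤s (s≤s (s≤s (s≤s z≤n))))) (m≤n⇒m≤1+n (m≤n⇒m≤1+n 13≤j))
  q²≡1+mj : suc j * suc j ≡ suc (suc (suc j) * j)
  q²≡1+mj = solve (List ℕ ∋ j ∷ [])
  cancel : ∀ {a F T X Y} k .{{_ : NonZero F}} → a * F ≤ T → T * X ≤ F * Y → a * (k * X) ≤ suc k * Y
  cancel {a} {F} {T} {X} {Y} k aF≤T TX≤FY = *-cancelˡ-≤ F (begin
    F * (a * (k * X))  ≡⟨ solve (List ℕ ∋ F ∷ a ∷ k ∷ X ∷ []) ⟩
    a * F * X * k      ≤⟨ *-monoˡ-≤ k (*-monoˡ-≤ X aF≤T) ⟩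
    T * X * k          ≤⟨ *-monoˡ-≤ k TX≤FY ⟩
    F * Y * k          ≤⟨ *-monoʳ-≤ (F * Y) (n≤1+n k) ⟩
    F * Y * suc k      ≡⟨ solve (List ℕ ∋ F ∷ Y ∷ k ∷ []) ⟩
    F * (suc k * Y)    ∎)

scaled-power-bound : ∀ q → 14 ≤ q → let n = q * q + q + 1 in
                     n * n * suc q ^ n ≤ (q + 1) ^ (q + 1) * (q + 2) ^ (n ∸ (q + 1))
scaled-power-bound q 14≤q = begin
  n * n * suc q ^ n                             ≡⟨ cong (λ e → n * n * suc q ^ e) n≡q²+[q+1] ⟩
  n * n * suc q ^ (q * q + (q + 1))             ≡⟨ cong (n * n *_) (^-distribˡ-+-* (suc q) (q * q) (q + 1)) ⟩
  n * n * (suc q ^ (q * q) * suc q ^ (q + 1))   ≡⟨ *-assoc (n * n) _ _ ⟨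
  n * n * suc q ^ (q * q) * suc q ^ (q + 1)
    ≤⟨ *-monoˡ-≤ (suc q ^ (q + 1)) (n²*[1+q]^q²≤[2+q]^q² q 14≤q) ⟩
  suc (suc q) ^ (q * q) * suc q ^ (q + 1)
    ≡⟨ *-comm (suc (suc q) ^ (q * q)) _ ⟩
  suc q ^ (q + 1) * suc (suc q) ^ (q * q)
    ≡⟨ cong₂ (λ a b → a ^ (q + 1) * b ^ (q * q)) (+-comm 1 q) (+-comm 2 q) ⟩
  (q + 1) ^ (q + 1) * (q + 2) ^ (q * q)
    ≡⟨ cong (λ e → (q + 1) ^ (q + 1) * (q + 2) ^ e) n∸[q+1]≡q² ⟨
  (q + 1) ^ (q + 1) * (q + 2) ^ (n ∸ (q + 1))
    ∎
  where
  open ≤-Reasoning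
  n = q * q + q + 1
  n≡q²+[q+1] : n ≡ q * q + (q + 1)
  n≡q²+[q+1] = +-assoc (q * q) q 1
  n∸[q+1]≡q² : n ∸ (q + 1) ≡ q * q
  n∸[q+1]≡q² = trans (cong (_∸ (q + 1)) n≡q²+[q+1]) (m+n∸n≡m (q * q) (q + 1))

proposition4p1 : (q : ℕ) → 14 ≤ q → (G : Graph (q * q + q + 1)) → Simple G → C4Free G →
    ScaledτBound G ((q * q + q + 1) * (q * q + q + 1))
    ((q + 1) ^ (q + 1) * (q + 2) ^ ((q * q + q + 1) ∸ (q + 1)))
proposition4p1 q 14≤q G simple c4free ts unique trees = begin
  n * n * length ts  ≤⟨ *-monoʳ-≤ (n * n) (SpanningTreeCount.spanningTrees≤ G root ts unique trees) ⟩
  n * n * product x  ≤⟨ *-monoʳ-≤ (n * n) (product≤pow (suc q) x ∑x≤[1+q]n) ⟩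
  n * n * suc q ^ n  ≤⟨ scaled-power-bound q 14≤q ⟩
  (q + 1) ^ (q + 1) * (q + 2) ^ (n ∸ (q + 1))  ∎
  where
  open ≤-Reasoning
  n = q * q + q + 1
  root : Fin n
  root = subst Fin (+-comm 1 (q * q + q)) zero
  x : Fin n → ℕ
  x v = degree G v ⊔ 1
  ∑x≤[1+q]n : sum x ≤ suc q * n
  ∑x≤[1+q]n = sum≤[1+q]*n q {{>-nonZero (≤-trans (s≤s z≤n) 14≤q)}}
                (∑[d⊔1]²≤ (degree G) (∑degree²≤ {G = G} simple c4free)) (∑-tangent q x)
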